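{- Let $G=(V,E)$ be an $n$-vertex graph, $T_{\mathsf{SD}}$ a separator decomposition tree of $G$, and $r\ge0$ an integer. For $v\in V$ let $N(v)$ be the number of nodes $(U,S)$ of $T_{\mathsf{SD}}$ with $v\in\mathsf{B}_U(S,r)$, and let $A=\max_{v\in V}N(v)$. (i) If $G$ has maximum degree $\Delta\ge3$, then $A\le 1+\Delta\sum_{i=0}^{r-1}(\Delta-1)^i=O(\Delta^r)$. (ii) If $n\ge3$ and $T_{\mathsf{SD}}$ is balanced, then $A\le 4\log n$ (natural logarithm).
   Context: For $S\subseteq U\subseteq V$, $\mathsf{B}_U(S,r)=\{v\in U:\mathrm{dist}_G(v,S)\le r\}$. A separator decomposition tree of $G$ is a rooted tree whose nodes are pairs $(U,S)$ with $S\subseteq U\subseteq V$, whose root is $(V,S_V)$ for some $S_V$, such that the children of each non-leaf node $(U,S)$ are exactly the pairs $(U',S')$ with $U'$ ranging over the connected components of $G[U\setminus S]$ (each with a chosen $S'\subseteq U'$), and every leaf has the form $(U,U)$. It is balanced if for every non-leaf node $(U,S)$ and every child $(U',S')$, $|U'|\le 2|U|/3$. -}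

module Defs where

open import Data.Nat using (ℕ; zero; suc; _+_; _*_; _^_; _≤_)
open import Data.Nat using (_!)
open import Data.Bool using (Bool; true; false; _∧_; _∨_; if_then_else_)
open import Data.Fin using (Fin)
import Data.Fin as F
open import Data.Fin.Subset using (Subset; _∈_; _⊆_; _∩_; _∪_; ∁; ∣_∣; Nonempty; Empty)
open import Data.Vec using (tabulate; lookup)
open import Data.List using (List; []; _∷_)
open import Data.List.Relation.Unary.All using (All)
open import Data.List.Relation.Unary.Any using (Any)
open import Data.List.Relation.Unary.AllPairs using (AllPairs)
open import Data.Product using (Σ; ∃; _×_; _,_; proj₁)
open import Data.Unit using () renaming (⊤ to Unit)
open import Relation.Binary.PropositionalEquality using (_≡_)

record Graph (n : ℕ) : Set where
  field
    adj    : Fin n → Fin n → Bool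
    sym    : ∀ u v → adj u v ≡ adj v u
    irrefl : ∀ v → adj v v ≡ false
open Graph public

module _ {n : ℕ} where

  anyB : ∀ {m} → (Fin m → Bool) → Bool
  anyB {zero} f = false
  anyB {suc m} f = f F.zero ∨ anyB (λ i → f (F.suc i))

  deg : Graph n → Fin n → ℕ
  deg G v = ∣ tabulate (adj G v) ∣

  MaxDegree : Graph n → ℕ → Set
  MaxDegree G Δ = (∀ v → deg G v ≤ Δ) × ∃ (λ v → deg G v ≡ Δ)

  nbr : Graph n → Subset n → Subset n
  nbr G X = tabulate (λ u → anyB (λ v → lookup X v ∧ adj G v u))

  within : Graph n → ℕ → Subset n → Subset n
  within G zero S = S
  within G (suc r) S = within G r S ∪ nbr G (within G r S)

  ball : Graph n → Subset n → Subset n → ℕ → Subset n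
  ball G U S r = U ∩ within G r S

  data PathIn (G : Graph n) (W : Subset n) : Fin n → Fin n → Set where
    here : ∀ {x} → x ∈ W → PathIn G W x x
    step : ∀ {x y z} → x ∈ W → adj G x y ≡ true → PathIn G W y z → PathIn G W x z

  IsComponent : Graph n → Subset n → Subset n → Set
  IsComponent G W C =
    Nonempty C × C ⊆ W
    × (∀ {x y} → x ∈ C → y ∈ C → PathIn G C x y)
    × (∀ {x y} → x ∈ C → y ∈ W → adj G x y ≡ true → y ∈ C)

  -- Separator decomposition tree; SDT G U = trees whose root node has first
  -- component U.  A node (U,S) with S ⊆ U has one child (U',S') for each
  -- connected component U' of G[U \ S]: every child's U' is a component,
  -- the children's vertex sets are pairwise disjoint (so distinct
  -- components), and they cover U \ S.  A node without children thus has
  -- U \ S = ∅, i.e. is of the form (U,U).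
  data SDT (G : Graph n) : Subset n → Set where
    node : ∀ {U} (S : Subset n) → S ⊆ U
         → (cs : List (Σ (Subset n) (SDT G)))
         → All (λ c → IsComponent G (U ∩ ∁ S) (proj₁ c)) cs
         → AllPairs (λ c d → Empty (proj₁ c ∩ proj₁ d)) cs
         → (∀ v → v ∈ U ∩ ∁ S → Any (λ c → v ∈ proj₁ c) cs)
         → SDT G U

  mutual
    countN : {G : Graph n} {U : Subset n} → ℕ → Fin n → SDT G U → ℕ
    countN {G} {U} r v (node S _ cs _ _ _) =
      (if lookup (ball G U S r) v then 1 else 0) + countL r v cs

    countL : {G : Graph n} → ℕ → Fin n → List (Σ (Subset n) (SDT G)) → ℕ
    countL r v [] = 0
    countL r v ((_ , t) ∷ cs) = countN r v t + countL r v cs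

  mutual
    Balanced : {G : Graph n} {U : Subset n} → SDT G U → Set
    Balanced {U = U} (node S _ cs _ _ _) = BalancedL U cs

    BalancedL : {G : Graph n} → Subset n → List (Σ (Subset n) (SDT G)) → Set
    BalancedL U [] = Unit
    BalancedL U ((U' , t) ∷ cs) = (3 * ∣ U' ∣ ≤ 2 * ∣ U ∣) × Balanced t × BalancedL U cs

geom : ℕ → ℕ → ℕ
geom q zero = 0
geom q (suc r) = geom q r + q ^ r

-- expSum A K = K! · Σ_{k=0}^{K} A^k / k!   (a natural number)
expSum : ℕ → ℕ → ℕ
expSum A zero = 1
expSum A (suc K) = suc K * expSum A K + A ^ suc K

-- A ≤ 4 ln n  ⇔  e^A ≤ n^4  ⇔  ∀ K, Σ_{k≤K} A^k/k! ≤ n^4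
LeFourLog : ℕ → ℕ → Set
LeFourLog A n = ∀ K → expSum A K ≤ n ^ 4 * K !

{-# OPTIONS --safe #-}
module Submission where

-- Only the nodes (U , S) with v ∈ U can count towards N(v), and they form a path down from
-- the root.  (i) A counted node owns a vertex s ∈ S at distance ≤ r from v, and s belongs to no
-- node below it, so N(v) is at most the size of the r-ball around v.  Every vertex at distance
-- i + 2 from v hangs off a vertex at distance i + 1, which already spends one of its ≤ Δ edges on
-- a vertex at distance i; double counting bounds the layers by Δ (Δ - 1)^i.
-- (ii) Along the path |U| shrinks by a factor 2/3 at each step, so 3^j ≤ n 2^j for j < N(v).  As
-- 2^3 ≤ 3^2 this gives 3^N(v) ≤ n^4, and e ≤ 3 turns it into e^N(v) ≤ n^4.  With the truncated
-- exponential e_K(x) = Σ_{k≤K} x^k/k! (so expSum x K = K! e_K(x)), the binomial theorem gives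
-- e_K(x+1) = Σ_{i≤K} (x^i/i!) e_{K-i}(1) ≤ e_K(1) e_K(x) ≤ 3 e_K(x).

open import Defs renaming (sym to adj-sym)
open import Data.Bool using (Bool; true; false; _∧_; if_then_else_)
open import Data.Bool.Properties using (∧-conicalˡ; ∧-conicalʳ)
open import Data.Empty using (⊥-elim)
open import Data.Fin as Fin using (Fin; toℕ)
open import Data.Fin.Properties using (¬Fin0; toℕ<n)
open import Data.Fin.Subset using (Subset; inside; outside; _∈_; _∉_; _⊆_; _⊂_; _∩_; ∁; ⁅_⁆; ∣_∣; ⊤; ⊥; Empty)
open import Data.Fin.Subset.Properties
open import Data.List using ([]; _∷_)
open import Data.List.Relation.Unary.All as All using (All; []; _∷_)
open import Data.List.Relation.Unary.AllPairs using (AllPairs; []; _∷_)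
open import Data.Nat using (ℕ; zero; suc; _+_; _*_; _∸_; _^_; _!; _≤_; _<_; _≤′_; ≤′-refl; ≤′-step; z≤n; s≤s; NonZero; >-nonZero; +-0-rawMonoid)
open import Data.Nat.Combinatorics using (_C_; nC1≡n; nCk+nC[k+1]≡[n+1]C[k+1])
open import Data.Nat.Properties
open import Data.Nat.Tactic.RingSolver using (solve-∀)
open import Data.Product using (Σ; ∃; _×_; _,_; proj₁; proj₂)
open import Data.Sum using (_⊎_; inj₁; inj₂)
open import Data.Vec using (_∷_; []; here; there; lookup; tabulate)
open import Data.Vec.Functional using (Vector)
open import Data.Vec.Properties using (lookup∘tabulate; []=⇒lookup; lookup⇒[]=)
open import Function using (id; _∘_; _$_)
open import Relation.Nullary using (yes; no)
open import Relation.Binary.PropositionalEquality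
open import Algebra.Definitions.RawMonoid +-0-rawMonoid using () renaming (_×_ to _×ᴹ_)
open import Algebra.Properties.CommutativeSemigroup *-commutativeSemigroup using (x∙yz≈y∙xz)
import Algebra.Properties.CommutativeSemiring.Binomial +-*-commutativeSemiring as Binomial
open import Algebra.Properties.Semiring.Exp +-*-semiring using () renaming (_^_ to _^ᴱ_)
open import Algebra.Properties.Semiring.Sum +-*-semiring
  using (sum; sum-syntax; sum⁺-syntax; sum-cong-≗; ∑-distrib-+; *-distribˡ-sum; *-distribʳ-sum)

-- Binomial coefficients and the truncated exponential

×ᴹ≡* : ∀ m x → m ×ᴹ x ≡ m * x
×ᴹ≡* zero x = refl
×ᴹ≡* (suc m) x = cong (x +_) (×ᴹ≡* m x)

^ᴱ≡^ : ∀ x m → x ^ᴱ m ≡ x ^ m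
^ᴱ≡^ x zero = refl
^ᴱ≡^ x (suc m) = cong (x *_) (^ᴱ≡^ x m)

binomial-suc : ∀ x K → suc x ^ K ≡ ∑[ i ≤ K ] ((K C toℕ i) * x ^ toℕ i)
binomial-suc x K = begin
  suc x ^ K                             ≡⟨ cong (_^ K) (+-comm 1 x) ⟩
  (x + 1) ^ K                           ≡⟨ ^ᴱ≡^ (x + 1) K ⟨
  (x + 1) ^ᴱ K                          ≡⟨ Binomial.theorem K x 1 ⟩
  Binomial.binomialExpansion x 1 K      ≡⟨ sum-cong-≗ term ⟩
  ∑[ i ≤ K ] ((K C toℕ i) * x ^ toℕ i)  ∎
  where
  open ≡-Reasoning
  term : ∀ i → Binomial.binomialTerm x 1 K i ≡ (K C toℕ i) * x ^ toℕ i
  term i = begin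
    Binomial.binomialTerm x 1 K i                 ≡⟨ ×ᴹ≡* (K C toℕ i) _ ⟩
    (K C toℕ i) * (x ^ᴱ toℕ i * 1 ^ᴱ (K ∸ toℕ i))  ≡⟨ cong₂ (λ a b → (K C toℕ i) * (a * b)) (^ᴱ≡^ x (toℕ i))
                                                            (trans (^ᴱ≡^ 1 (K ∸ toℕ i)) (^-zeroˡ (K ∸ toℕ i))) ⟩
    (K C toℕ i) * (x ^ toℕ i * 1)                 ≡⟨ cong ((K C toℕ i) *_) (*-identityʳ _) ⟩
    (K C toℕ i) * x ^ toℕ i                       ∎

∑-mono-≤ : ∀ {m} {f g : Vector ℕ m} → (∀ i → f i ≤ g i) → sum f ≤ sum g
∑-mono-≤ {zero} f≤g = z≤n
∑-mono-≤ {suc m} f≤g = +-mono-≤ (f≤g Fin.zero) (∑-mono-≤ (λ i → f≤g (Fin.suc i)))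

C-absorption : ∀ n k → (suc n C suc k) * suc k ≡ suc n * (n C k)
C-absorption zero zero = refl
C-absorption zero (suc k) = refl
C-absorption (suc n) zero = trans (*-identityʳ _) (trans (nC1≡n (suc (suc n))) (sym (*-identityʳ _)))
C-absorption (suc n) (suc k) = begin
  (suc (suc n) C suc (suc k)) * suc (suc k)
    ≡⟨ cong (_* suc (suc k)) (nCk+nC[k+1]≡[n+1]C[k+1] (suc n) (suc k)) ⟨
  ((suc n C suc k) + (suc n C suc (suc k))) * suc (suc k)
    ≡⟨ *-distribʳ-+ (suc (suc k)) (suc n C suc k) _ ⟩
  (suc n C suc k) * suc (suc k) + (suc n C suc (suc k)) * suc (suc k)
    ≡⟨ cong₂ _+_ (*-suc (suc n C suc k) (suc k)) (C-absorption n (suc k)) ⟩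
  (suc n C suc k) + (suc n C suc k) * suc k + suc n * (n C suc k)
    ≡⟨ cong (λ z → (suc n C suc k) + z + suc n * (n C suc k)) (C-absorption n k) ⟩
  (suc n C suc k) + suc n * (n C k) + suc n * (n C suc k)
    ≡⟨ +-assoc (suc n C suc k) _ _ ⟩
  (suc n C suc k) + (suc n * (n C k) + suc n * (n C suc k))
    ≡⟨ cong ((suc n C suc k) +_) (*-distribˡ-+ (suc n) (n C k) (n C suc k)) ⟨
  (suc n C suc k) + suc n * ((n C k) + (n C suc k))
    ≡⟨ cong (λ c → (suc n C suc k) + suc n * c) (nCk+nC[k+1]≡[n+1]C[k+1] n k) ⟩
  suc (suc n) * (suc n C suc k) ∎
  where open ≡-Reasoning

C-absorption-* : ∀ n k y → (suc n C suc k) * (suc k * y) ≡ suc n * ((n C k) * y)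
C-absorption-* n k y = begin
  (suc n C suc k) * (suc k * y) ≡⟨ *-assoc (suc n C suc k) (suc k) y ⟨
  (suc n C suc k) * suc k * y   ≡⟨ cong (_* y) (C-absorption n k) ⟩
  suc n * (n C k) * y           ≡⟨ *-assoc (suc n) (n C k) y ⟩
  suc n * ((n C k) * y)         ∎
  where open ≡-Reasoning

expSum-suc≡∑C*expSum : ∀ x K → expSum (suc x) K ≡ ∑[ i ≤ K ] ((K C toℕ i) * expSum x (toℕ i))
expSum-suc≡∑C*expSum x zero = refl
expSum-suc≡∑C*expSum x (suc K) = sym $ begin
  ∑[ i ≤ suc K ] ((suc K C toℕ i) * expSum x (toℕ i))
    ≡⟨ cong suc (sum-cong-≗ term) ⟩ -- the i = 0 term reduces to 1
  1 + ∑[ i ≤ K ] (suc K * a i + b i)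
    ≡⟨ cong suc (∑-distrib-+ (λ i → suc K * a i) b) ⟩
  1 + (∑[ i ≤ K ] (suc K * a i) + sum b)
    ≡⟨ cong (λ s → 1 + (s + sum b)) (*-distribˡ-sum (suc K) a) ⟨
  1 + (suc K * sum a + sum b)
    ≡⟨ +-suc (suc K * sum a) (sum b) ⟨
  suc K * sum a + ∑[ i ≤ suc K ] ((suc K C toℕ i) * x ^ toℕ i)
    ≡⟨ cong₂ (λ s t → suc K * s + t) (expSum-suc≡∑C*expSum x K) (binomial-suc x (suc K)) ⟨
  expSum (suc x) (suc K) ∎
  where
  open ≡-Reasoning
  a b : Vector ℕ (suc K)
  a i = (K C toℕ i) * expSum x (toℕ i)
  b i = (suc K C suc (toℕ i)) * x ^ suc (toℕ i)
  term : ∀ i → (suc K C suc (toℕ i)) * expSum x (suc (toℕ i)) ≡ suc K * a i + b i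
  term i = trans (*-distribˡ-+ (suc K C suc (toℕ i)) _ _)
                 (cong (_+ b i) (C-absorption-* K (toℕ i) (expSum x (toℕ i))))

expSum/!-mono : ∀ x {i K} → i ≤′ K → K ! * expSum x i ≤ i ! * expSum x K
expSum/!-mono x ≤′-refl = ≤-refl
expSum/!-mono x {i} {suc K} (≤′-step i≤K) = begin
  suc K * K ! * expSum x i           ≡⟨ *-assoc (suc K) (K !) _ ⟩
  suc K * (K ! * expSum x i)         ≤⟨ *-monoʳ-≤ (suc K) (expSum/!-mono x i≤K) ⟩
  suc K * (i ! * expSum x K)         ≡⟨ x∙yz≈y∙xz (suc K) (i !) _ ⟩
  i ! * (suc K * expSum x K)         ≤⟨ *-monoʳ-≤ (i !) (m≤m+n _ (x ^ suc K)) ⟩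
  i ! * expSum x (suc K)             ∎
  where open ≤-Reasoning

∑C*!≡expSum-1 : ∀ K → ∑[ i ≤ K ] ((K C toℕ i) * toℕ i !) ≡ expSum 1 K
∑C*!≡expSum-1 zero = refl
∑C*!≡expSum-1 (suc K) = begin
  1 + ∑[ i ≤ K ] ((suc K C suc (toℕ i)) * suc (toℕ i) !)
    ≡⟨ cong suc (sum-cong-≗ {suc K} (λ i → C-absorption-* K (toℕ i) (toℕ i !))) ⟩
  1 + ∑[ i ≤ K ] (suc K * w i)
    ≡⟨ cong suc (*-distribˡ-sum (suc K) w) ⟨
  1 + suc K * sum w
    ≡⟨ cong (λ s → 1 + suc K * s) (∑C*!≡expSum-1 K) ⟩
  1 + suc K * expSum 1 K
    ≡⟨ +-comm 1 _ ⟩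
  suc K * expSum 1 K + 1
    ≡⟨ cong (suc K * expSum 1 K +_) (^-zeroˡ (suc K)) ⟨
  expSum 1 (suc K) ∎
  where
  open ≡-Reasoning
  w : Vector ℕ (suc K)
  w i = (K C toℕ i) * toℕ i !

e≤3 : ∀ K → expSum 1 K ≤ 3 * K !
e≤3 zero = s≤s z≤n
e≤3 (suc K) = ≤-trans (n≤1+n _) (e+1/K!≤3 K)
  where
  e+1/K!≤3 : ∀ K → suc (expSum 1 (suc K)) ≤ 3 * suc K !
  e+1/K!≤3 zero = ≤-refl
  e+1/K!≤3 (suc K) = begin
    suc (m * E + 1 ^ m)   ≡⟨ cong (λ t → suc (m * E + t)) (^-zeroˡ m) ⟩
    suc (m * E + 1)       ≡⟨ +-suc (m * E) 1 ⟨
    m * E + 2             ≤⟨ +-monoʳ-≤ (m * E) (s≤s (s≤s z≤n)) ⟩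
    m * E + m             ≡⟨ +-comm (m * E) m ⟩
    m + m * E             ≡⟨ *-suc m E ⟨
    m * suc E             ≤⟨ *-monoʳ-≤ m (e+1/K!≤3 K) ⟩
    m * (3 * suc K !)     ≡⟨ x∙yz≈y∙xz m 3 (suc K !) ⟩
    3 * m !               ∎
    where
    open ≤-Reasoning
    m = suc (suc K)
    E = expSum 1 (suc K)

expSum-suc≤3* : ∀ x K → expSum (suc x) K ≤ 3 * expSum x K
expSum-suc≤3* x K = *-cancelˡ-≤ (K !) {{K !≢0}} $ begin
  K ! * expSum (suc x) K                                   ≡⟨ cong (K ! *_) (expSum-suc≡∑C*expSum x K) ⟩
  K ! * ∑[ i ≤ K ] ((K C toℕ i) * expSum x (toℕ i))        ≡⟨ *-distribˡ-sum (K !) a ⟩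
  ∑[ i ≤ K ] (K ! * ((K C toℕ i) * expSum x (toℕ i)))      ≤⟨ ∑-mono-≤ {suc K} term ⟩
  ∑[ i ≤ K ] ((K C toℕ i) * toℕ i ! * expSum x K)          ≡⟨ *-distribʳ-sum (expSum x K) w ⟨
  ∑[ i ≤ K ] ((K C toℕ i) * toℕ i !) * expSum x K          ≡⟨ cong (_* expSum x K) (∑C*!≡expSum-1 K) ⟩
  expSum 1 K * expSum x K                                  ≤⟨ *-monoˡ-≤ (expSum x K) (e≤3 K) ⟩
  3 * K ! * expSum x K                                     ≡⟨ trans (*-assoc 3 (K !) _) (x∙yz≈y∙xz 3 (K !) _) ⟩
  K ! * (3 * expSum x K)                                   ∎
  where
  open ≤-Reasoning
  a w : Vector ℕ (suc K)
  a i = (K C toℕ i) * expSum x (toℕ i)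
  w i = (K C toℕ i) * toℕ i !
  term : ∀ i → K ! * ((K C toℕ i) * expSum x (toℕ i)) ≤ (K C toℕ i) * toℕ i ! * expSum x K
  term i = begin
    K ! * ((K C toℕ i) * expSum x (toℕ i))  ≡⟨ x∙yz≈y∙xz (K !) (K C toℕ i) _ ⟩
    (K C toℕ i) * (K ! * expSum x (toℕ i))  ≤⟨ *-monoʳ-≤ (K C toℕ i) (expSum/!-mono x (≤⇒≤′ (≤-pred (toℕ<n i)))) ⟩
    (K C toℕ i) * (toℕ i ! * expSum x K)    ≡⟨ *-assoc (K C toℕ i) (toℕ i !) _ ⟨
    (K C toℕ i) * toℕ i ! * expSum x K      ∎

e^x≤3^x : ∀ x K → expSum x K ≤ 3 ^ x * K !
e^x≤3^x zero K = ≤-reflexive (trans (expSum-zero K) (sym (*-identityˡ (K !))))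
  where
  expSum-zero : ∀ K → expSum 0 K ≡ K !
  expSum-zero zero = refl
  expSum-zero (suc K) = trans (+-identityʳ _) (cong (suc K *_) (expSum-zero K))
e^x≤3^x (suc x) K = begin
  expSum (suc x) K    ≤⟨ expSum-suc≤3* x K ⟩
  3 * expSum x K      ≤⟨ *-monoʳ-≤ 3 (e^x≤3^x x K) ⟩
  3 * (3 ^ x * K !)   ≡⟨ *-assoc 3 (3 ^ x) (K !) ⟨
  3 ^ suc x * K !     ∎
  where open ≤-Reasoning

2^k³≤3^k² : ∀ k → 2 ^ k * (2 ^ k * 2 ^ k) ≤ 3 ^ k * 3 ^ k
2^k³≤3^k² zero = ≤-refl
2^k³≤3^k² (suc k) = begin
  (2 * u) * ((2 * u) * (2 * u))  ≡⟨ cube-2* u ⟩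
  8 * (u * (u * u))              ≤⟨ *-mono-≤ (n≤1+n 8) (2^k³≤3^k² k) ⟩
  9 * (t * t)                    ≡⟨ square-3* t ⟨
  (3 * t) * (3 * t)              ∎
  where
  open ≤-Reasoning
  u = 2 ^ k
  t = 3 ^ k
  cube-2* : ∀ u → (2 * u) * ((2 * u) * (2 * u)) ≡ 8 * (u * (u * u))
  cube-2* = solve-∀
  square-3* : ∀ t → (3 * t) * (3 * t) ≡ 9 * (t * t)
  square-3* = solve-∀

3^k≤n2^k⇒3^k≤n³ : ∀ n k → 3 ^ k ≤ n * 2 ^ k → 3 ^ k ≤ n * (n * n)
3^k≤n2^k⇒3^k≤n³ n k 3^k≤n2^k = *-cancelʳ-≤ t (n * (n * n)) (t * t) {{t*t≢0}} $ begin
  t * (t * t)                        ≤⟨ *-mono-≤ 3^k≤n2^k (*-mono-≤ 3^k≤n2^k 3^k≤n2^k) ⟩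
  (n * u) * ((n * u) * (n * u))      ≡⟨ cube-* n u ⟩
  (n * (n * n)) * (u * (u * u))      ≤⟨ *-monoʳ-≤ (n * (n * n)) (2^k³≤3^k² k) ⟩
  (n * (n * n)) * (t * t)            ∎
  where
  open ≤-Reasoning
  u = 2 ^ k
  t = 3 ^ k
  t*t≢0 : NonZero (t * t)
  t*t≢0 = m*n≢0 t t {{m^n≢0 3 k}} {{m^n≢0 3 k}}
  cube-* : ∀ n u → (n * u) * ((n * u) * (n * u)) ≡ (n * (n * n)) * (u * (u * u))
  cube-* = solve-∀

3^j≤n2^j⇒LeFourLog : ∀ {n c} → 3 ≤ n → (∀ j → j < c → 3 ^ j ≤ n * 2 ^ j) → LeFourLog c n
3^j≤n2^j⇒LeFourLog {n} {c} 3≤n 3^j≤n2^j K = ≤-trans (e^x≤3^x c K) (*-monoˡ-≤ (K !) (3^c≤n⁴ c 3^j≤n2^j))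
  where
  3^c≤n⁴ : ∀ c → (∀ j → j < c → 3 ^ j ≤ n * 2 ^ j) → 3 ^ c ≤ n ^ 4
  3^c≤n⁴ zero _ = m^n>0 n {{>-nonZero (≤-trans (s≤s z≤n) 3≤n)}} 4
  3^c≤n⁴ (suc k) 3^j≤n2^j = begin
    3 * 3 ^ k                ≤⟨ *-mono-≤ 3≤n (3^k≤n2^k⇒3^k≤n³ n k (3^j≤n2^j k ≤-refl)) ⟩
    n * (n * (n * n))        ≡⟨ cong (λ m → n * (n * (n * m))) (*-identityʳ n) ⟨
    n ^ 4                    ∎
    where open ≤-Reasoning

-- Counting subsets

∣p∣≡∣p∩q∣+∣p∩∁q∣ : ∀ {m} (p q : Subset m) → ∣ p ∣ ≡ ∣ p ∩ q ∣ + ∣ p ∩ ∁ q ∣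
∣p∣≡∣p∩q∣+∣p∩∁q∣ [] [] = refl
∣p∣≡∣p∩q∣+∣p∩∁q∣ (outside ∷ p) (_ ∷ q) = ∣p∣≡∣p∩q∣+∣p∩∁q∣ p q
∣p∣≡∣p∩q∣+∣p∩∁q∣ (inside ∷ p) (inside ∷ q) = cong suc (∣p∣≡∣p∩q∣+∣p∩∁q∣ p q)
∣p∣≡∣p∩q∣+∣p∩∁q∣ (inside ∷ p) (outside ∷ q) = trans (cong suc (∣p∣≡∣p∩q∣+∣p∩∁q∣ p q)) (sym (+-suc _ _))

∩-monoˡ-⊆ : ∀ {m} {p q r : Subset m} → p ⊆ q → p ∩ r ⊆ q ∩ r
∩-monoˡ-⊆ p⊆q x∈ with x∈p∩q⁻ _ _ x∈
... | x∈p , x∈r = x∈p∩q⁺ (p⊆q x∈p , x∈r)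

∣p∣≤∣q∣*c : ∀ {m k c} {p : Subset m} (q : Subset k) (F : Fin k → Subset m) →
            (∀ {u} → u ∈ p → ∃ λ w → w ∈ q × u ∈ F w) →
            (∀ {w} → w ∈ q → ∣ p ∩ F w ∣ ≤ c) →
            ∣ p ∣ ≤ ∣ q ∣ * c
∣p∣≤∣q∣*c {m} {p = p} [] F cover _ = ≤-reflexive (trans (cong ∣_∣ p≡⊥) (∣⊥∣≡0 m))
  where
  p≡⊥ : p ≡ ⊥
  p≡⊥ = Empty-unique λ (_ , u∈p) → ¬Fin0 (proj₁ (cover u∈p))
∣p∣≤∣q∣*c {p = p} (outside ∷ q) F cover fibre = ∣p∣≤∣q∣*c q (F ∘ Fin.suc) cover′ (fibre ∘ there)
  where
  cover′ : ∀ {u} → u ∈ p → ∃ λ w → w ∈ q × u ∈ F (Fin.suc w)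
  cover′ u∈p with cover u∈p
  ... | Fin.suc w , there w∈q , u∈Fw = w , w∈q , u∈Fw
∣p∣≤∣q∣*c {c = c} {p = p} (inside ∷ q) F cover fibre = begin
  ∣ p ∣                        ≡⟨ ∣p∣≡∣p∩q∣+∣p∩∁q∣ p F₀ ⟩
  ∣ p ∩ F₀ ∣ + ∣ p ∩ ∁ F₀ ∣    ≤⟨ +-mono-≤ (fibre here) (∣p∣≤∣q∣*c q (F ∘ Fin.suc) cover′ fibre′) ⟩
  c + ∣ q ∣ * c                ∎
  where
  open ≤-Reasoning
  F₀ = F Fin.zero
  cover′ : ∀ {u} → u ∈ p ∩ ∁ F₀ → ∃ λ w → w ∈ q × u ∈ F (Fin.suc w)
  cover′ u∈p∖F₀ with x∈p∩q⁻ p _ u∈p∖F₀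
  ... | u∈p , u∈∁F₀ with cover u∈p
  ... | Fin.zero , _ , u∈F₀ = ⊥-elim (x∈∁p⇒x∉p u∈∁F₀ u∈F₀)
  ... | Fin.suc w , there w∈q , u∈Fw = w , w∈q , u∈Fw
  fibre′ : ∀ {w} → w ∈ q → ∣ (p ∩ ∁ F₀) ∩ F (Fin.suc w) ∣ ≤ c
  fibre′ w∈q = ≤-trans (p⊆q⇒∣p∣≤∣q∣ (∩-monoˡ-⊆ (p∩q⊆p p (∁ F₀)))) (fibre (there w∈q))

-- Balls in a graph

∈-tabulate⁺ : ∀ {m} {f : Fin m → Bool} {x} → f x ≡ true → x ∈ tabulate f
∈-tabulate⁺ {f = f} {x} fx = lookup⇒[]= x (tabulate f) (trans (lookup∘tabulate f x) fx)

∈-tabulate⁻ : ∀ {m} {f : Fin m → Bool} {x} → x ∈ tabulate f → f x ≡ true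
∈-tabulate⁻ {f = f} {x} x∈ = trans (sym (lookup∘tabulate f x)) ([]=⇒lookup x∈)

∧-intro : ∀ {a b} → a ≡ true → b ≡ true → a ∧ b ≡ true
∧-intro refl refl = refl

-- The first implicit argument of anyB is the unused parameter of the anonymous module in Defs.
anyB⁺ : ∀ {k m} (f : Fin m → Bool) i → f i ≡ true → anyB {k} f ≡ true
anyB⁺ f Fin.zero fi rewrite fi = refl
anyB⁺ {k} f (Fin.suc i) fi with f Fin.zero
... | true = refl
... | false = anyB⁺ {k} (λ j → f (Fin.suc j)) i fi

anyB⁻ : ∀ {k m} (f : Fin m → Bool) → anyB {k} f ≡ true → ∃ λ i → f i ≡ true
anyB⁻ {k} {suc m} f any with f Fin.zero in f0
... | true = Fin.zero , f0
... | false with anyB⁻ {k} (λ j → f (Fin.suc j)) any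
... | i , fi = Fin.suc i , fi

module _ {n} (G : Graph n) where

  ∈-nbr⁺ : ∀ {X x u} → x ∈ X → adj G x u ≡ true → u ∈ nbr G X
  ∈-nbr⁺ {X} {x} {u} x∈X xu = ∈-tabulate⁺ (anyB⁺ {n} (λ y → lookup X y ∧ adj G y u) x (∧-intro ([]=⇒lookup x∈X) xu))

  ∈-nbr⁻ : ∀ {X u} → u ∈ nbr G X → ∃ λ x → x ∈ X × adj G x u ≡ true
  ∈-nbr⁻ {X} {u} u∈ with anyB⁻ {n} (λ y → lookup X y ∧ adj G y u) (∈-tabulate⁻ u∈)
  ... | x , Xx∧xu = x , lookup⇒[]= x X (∧-conicalˡ _ _ Xx∧xu) , ∧-conicalʳ _ _ Xx∧xu

  nbr-mono : ∀ {X Y} → X ⊆ Y → nbr G X ⊆ nbr G Y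
  nbr-mono X⊆Y u∈ with ∈-nbr⁻ u∈
  ... | x , x∈X , xu = ∈-nbr⁺ (X⊆Y x∈X) xu

  within-⊆-suc : ∀ r {X} → within G r X ⊆ within G (suc r) X
  within-⊆-suc r = p⊆p∪q _

  ∈-within-suc⁺ : ∀ r {X x u} → x ∈ within G r X → adj G x u ≡ true → u ∈ within G (suc r) X
  ∈-within-suc⁺ r x∈ xu = q⊆p∪q _ _ (∈-nbr⁺ x∈ xu)

  ∈-within-suc⁻ : ∀ r {X u} → u ∈ within G (suc r) X →
                  u ∈ within G r X ⊎ ∃ λ x → x ∈ within G r X × adj G x u ≡ true
  ∈-within-suc⁻ r u∈ with x∈p∪q⁻ _ _ u∈
  ... | inj₁ u∈W = inj₁ u∈W
  ... | inj₂ u∈N = inj₂ (∈-nbr⁻ u∈N)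

  within-mono-⊆ : ∀ r {X Y} → X ⊆ Y → within G r X ⊆ within G r Y
  within-mono-⊆ zero X⊆Y = X⊆Y
  within-mono-⊆ (suc r) X⊆Y u∈ with x∈p∪q⁻ _ _ u∈
  ... | inj₁ u∈W = p⊆p∪q _ (within-mono-⊆ r X⊆Y u∈W)
  ... | inj₂ u∈N = q⊆p∪q _ _ (nbr-mono (within-mono-⊆ r X⊆Y) u∈N)

  within-within-1⊆within-suc : ∀ r {X} → within G r (within G 1 X) ⊆ within G (suc r) X
  within-within-1⊆within-suc zero = id
  within-within-1⊆within-suc (suc r) u∈ with x∈p∪q⁻ _ _ u∈
  ... | inj₁ u∈W = p⊆p∪q _ (within-within-1⊆within-suc r u∈W)
  ... | inj₂ u∈N = q⊆p∪q _ _ (nbr-mono (within-within-1⊆within-suc r) u∈N)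

  within-sym : ∀ r {X u} → u ∈ within G r X → ∃ λ x → x ∈ X × x ∈ within G r ⁅ u ⁆
  within-sym zero {u = u} u∈X = u , u∈X , x∈⁅x⁆ u
  within-sym (suc r) u∈ with ∈-within-suc⁻ r u∈
  ... | inj₁ u∈W with within-sym r u∈W
  ...   | x , x∈X , x∈Wu = x , x∈X , within-⊆-suc r x∈Wu
  within-sym (suc r) {u = u} u∈ | inj₂ (y , y∈W , yu) with within-sym r y∈W
  ...   | x , x∈X , x∈Wy = x , x∈X , within-within-1⊆within-suc r (within-mono-⊆ r y∈W1u x∈Wy)
    where
    y∈W1u : ⁅ y ⁆ ⊆ within G 1 ⁅ u ⁆
    y∈W1u z∈⁅y⁆ rewrite x∈⁅y⁆⇒x≡y y z∈⁅y⁆ = ∈-within-suc⁺ 0 (x∈⁅x⁆ u) (trans (adj-sym G u y) yu)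

nbhd : ∀ {n} → Graph n → Fin n → Subset n
nbhd G w = tabulate (adj G w)

module _ {n} (G : Graph n) {Δ} (deg≤Δ : ∀ w → deg G w ≤ Δ) (X : Subset n) where

  layer : ℕ → Subset n
  layer i = within G (suc i) X ∩ ∁ (within G i X)

  ∣within-suc∣≤ : ∀ i → ∣ within G (suc i) X ∣ ≤ ∣ within G i X ∣ + ∣ layer i ∣
  ∣within-suc∣≤ i = begin
    ∣ within G (suc i) X ∣
      ≡⟨ ∣p∣≡∣p∩q∣+∣p∩∁q∣ (within G (suc i) X) (within G i X) ⟩
    ∣ within G (suc i) X ∩ within G i X ∣ + ∣ layer i ∣
      ≤⟨ +-monoˡ-≤ ∣ layer i ∣ (∣p∩q∣≤∣q∣ (within G (suc i) X) (within G i X)) ⟩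
    ∣ within G i X ∣ + ∣ layer i ∣ ∎
    where open ≤-Reasoning

  layer-parent : ∀ i {u} → u ∈ layer i → ∃ λ w → w ∈ within G i X × adj G w u ≡ true
  layer-parent i u∈ with x∈p∩q⁻ _ _ u∈
  ... | u∈W[1+i] , u∉W[i] with ∈-within-suc⁻ G i u∈W[1+i]
  ... | inj₁ u∈W[i] = ⊥-elim (x∈∁p⇒x∉p u∉W[i] u∈W[i])
  ... | inj₂ parent = parent

  ∣layer-zero∣≤ : ∣ layer 0 ∣ ≤ ∣ X ∣ * Δ
  ∣layer-zero∣≤ = ∣p∣≤∣q∣*c X (nbhd G) cover (λ {w} _ → ≤-trans (∣p∩q∣≤∣q∣ (layer 0) (nbhd G w)) (deg≤Δ w))
    where
    cover : ∀ {u} → u ∈ layer 0 → ∃ λ w → w ∈ X × u ∈ nbhd G w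
    cover u∈ with layer-parent 0 u∈
    ... | w , w∈X , wu = w , w∈X , ∈-tabulate⁺ wu

  ∣layer-suc∣≤ : ∀ i → ∣ layer (suc i) ∣ ≤ ∣ layer i ∣ * (Δ ∸ 1)
  ∣layer-suc∣≤ i = ∣p∣≤∣q∣*c (layer i) (nbhd G) cover fibre
    where
    cover : ∀ {u} → u ∈ layer (suc i) → ∃ λ w → w ∈ layer i × u ∈ nbhd G w
    cover u∈ with layer-parent (suc i) u∈
    ... | w , w∈W[1+i] , wu = w , x∈p∩q⁺ (w∈W[1+i] , x∉p⇒x∈∁p w∉W[i]) , ∈-tabulate⁺ wu
      where
      w∉W[i] : w ∉ within G i X
      w∉W[i] w∈W[i] = x∈∁p⇒x∉p (proj₂ (x∈p∩q⁻ _ _ u∈)) (∈-within-suc⁺ G i w∈W[i] wu)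
    fibre : ∀ {w} → w ∈ layer i → ∣ layer (suc i) ∩ nbhd G w ∣ ≤ Δ ∸ 1
    fibre {w} w∈ with layer-parent i w∈
    ... | p , p∈W[i] , pw = ∸-monoˡ-≤ 1 (≤-trans (p⊂q⇒∣p∣<∣q∣ ⊂nbhd) (deg≤Δ w))
      where
      p∉ : p ∉ layer (suc i) ∩ nbhd G w
      p∉ p∈ = x∈∁p⇒x∉p (proj₂ (x∈p∩q⁻ _ _ (proj₁ (x∈p∩q⁻ _ _ p∈)))) (within-⊆-suc G i p∈W[i])
      ⊂nbhd : layer (suc i) ∩ nbhd G w ⊂ nbhd G w
      ⊂nbhd = p∩q⊆q _ _ , p , ∈-tabulate⁺ (trans (adj-sym G w p) pw) , p∉

  ∣layer∣≤ : ∀ i → ∣ layer i ∣ ≤ ∣ X ∣ * Δ * (Δ ∸ 1) ^ i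
  ∣layer∣≤ zero = ≤-trans ∣layer-zero∣≤ (≤-reflexive (sym (*-identityʳ _)))
  ∣layer∣≤ (suc i) = begin
    ∣ layer (suc i) ∣                      ≤⟨ ∣layer-suc∣≤ i ⟩
    ∣ layer i ∣ * (Δ ∸ 1)                  ≤⟨ *-monoˡ-≤ (Δ ∸ 1) (∣layer∣≤ i) ⟩
    ∣ X ∣ * Δ * (Δ ∸ 1) ^ i * (Δ ∸ 1)      ≡⟨ *-assoc (∣ X ∣ * Δ) _ _ ⟩
    ∣ X ∣ * Δ * ((Δ ∸ 1) ^ i * (Δ ∸ 1))    ≡⟨ cong (∣ X ∣ * Δ *_) (*-comm _ (Δ ∸ 1)) ⟩
    ∣ X ∣ * Δ * (Δ ∸ 1) ^ suc i            ∎
    where open ≤-Reasoning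

  ∣within∣≤ : ∀ r → ∣ within G r X ∣ ≤ ∣ X ∣ * (1 + Δ * geom (Δ ∸ 1) r)
  ∣within∣≤ zero = ≤-reflexive (arith ∣ X ∣ Δ)
    where
    arith : ∀ x d → x ≡ x * (1 + d * 0)
    arith = solve-∀
  ∣within∣≤ (suc r) = begin
    ∣ within G (suc r) X ∣                                          ≤⟨ ∣within-suc∣≤ r ⟩
    ∣ within G r X ∣ + ∣ layer r ∣                                   ≤⟨ +-mono-≤ (∣within∣≤ r) (∣layer∣≤ r) ⟩
    ∣ X ∣ * (1 + Δ * geom (Δ ∸ 1) r) + ∣ X ∣ * Δ * (Δ ∸ 1) ^ r      ≡⟨ arith ∣ X ∣ Δ (geom (Δ ∸ 1) r) ((Δ ∸ 1) ^ r) ⟩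
    ∣ X ∣ * (1 + Δ * geom (Δ ∸ 1) (suc r))                         ∎
    where
    open ≤-Reasoning
    arith : ∀ x d g p → x * (1 + d * g) + x * d * p ≡ x * (1 + d * (g + p))
    arith = solve-∀

-- Separator decomposition trees

Child : ∀ {n} → Graph n → Set
Child {n} G = Σ (Subset n) (SDT G)

Disjoint : ∀ {n} {G : Graph n} → Child G → Child G → Set
Disjoint c d = Empty (proj₁ c ∩ proj₁ d)

component⊆ : ∀ {n} {G : Graph n} {W C} → IsComponent G W C → C ⊆ W
component⊆ = proj₁ ∘ proj₂

suc<indicator+⇒< : ∀ b {j m} → suc j < (if b then 1 else 0) + m → j < m
suc<indicator+⇒< true = ≤-pred
suc<indicator+⇒< false = ≤-trans (n≤1+n _)

3^j≤a2^j⇒3^[1+j]≤b2^[1+j] : ∀ a b j → 3 * a ≤ 2 * b → 3 ^ j ≤ a * 2 ^ j → 3 ^ suc j ≤ b * 2 ^ suc j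
3^j≤a2^j⇒3^[1+j]≤b2^[1+j] a b j 3a≤2b 3^j≤a2^j = begin
  3 * 3 ^ j         ≤⟨ *-monoʳ-≤ 3 3^j≤a2^j ⟩
  3 * (a * 2 ^ j)   ≡⟨ *-assoc 3 a (2 ^ j) ⟨
  3 * a * 2 ^ j     ≤⟨ *-monoˡ-≤ (2 ^ j) 3a≤2b ⟩
  2 * b * 2 ^ j     ≡⟨ cong (_* 2 ^ j) (*-comm 2 b) ⟩
  b * 2 * 2 ^ j     ≡⟨ *-assoc b 2 (2 ^ j) ⟩
  b * (2 * 2 ^ j)   ∎
  where open ≤-Reasoning

module _ {n} {G : Graph n} (r : ℕ) (v : Fin n) where

  mutual
    countN-∉ : ∀ {U} (T : SDT G U) → v ∉ U → countN r v T ≡ 0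
    countN-∉ {U} (node S _ cs comps _ _) v∉U =
      cong₂ _+_ ball-term (countL-∉ cs (All.map (λ {c} → v∉child {c}) comps))
      where
      ball-term : (if lookup (ball G U S r) v then 1 else 0) ≡ 0
      ball-term with lookup (ball G U S r) v in eq
      ... | false = refl
      ... | true = ⊥-elim (v∉U (proj₁ (x∈p∩q⁻ _ _ (lookup⇒[]= v (ball G U S r) eq))))
      v∉child : ∀ {c : Child G} → IsComponent G (U ∩ ∁ S) (proj₁ c) → v ∉ proj₁ c
      v∉child comp v∈c = v∉U (proj₁ (x∈p∩q⁻ _ _ (component⊆ comp v∈c)))

    countL-∉ : ∀ cs → All (λ (c : Child G) → v ∉ proj₁ c) cs → countL r v cs ≡ 0
    countL-∉ [] [] = refl
    countL-∉ ((_ , t) ∷ cs) (v∉ ∷ v∉s) = cong₂ _+_ (countN-∉ t v∉) (countL-∉ cs v∉s)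

  countN>0⇒∈ : ∀ {U} (T : SDT G U) → 0 < countN r v T → v ∈ U
  countN>0⇒∈ {U} T 0<N with v ∈? U
  ... | yes v∈U = v∈U
  ... | no v∉U = ⊥-elim (<-irrefl (sym (countN-∉ T v∉U)) 0<N)

  countL-via-child : ∀ (P : ℕ → Set) {cs} → AllPairs Disjoint cs → P 0 →
                     All (λ (c : Child G) → v ∈ proj₁ c → P (countN r v (proj₂ c))) cs →
                     P (countL r v cs)
  countL-via-child P [] P0 [] = P0
  countL-via-child P {(U′ , t) ∷ cs} (disj ∷ disjs) P0 (Pt ∷ Ps) with v ∈? U′
  ... | yes v∈U′ = subst P (sym countL≡countN) (Pt v∈U′)
    where
    v∉ : ∀ {c : Child G} → Disjoint (U′ , t) c → v ∉ proj₁ c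
    v∉ empty v∈c = empty (v , x∈p∩q⁺ (v∈U′ , v∈c))
    countL≡countN : countN r v t + countL r v cs ≡ countN r v t
    countL≡countN = trans (cong (countN r v t +_) (countL-∉ cs (All.map (λ {c} → v∉ {c}) disj))) (+-identityʳ _)
  ... | no v∉U′ = subst P (cong (_+ countL r v cs) (sym (countN-∉ t v∉U′))) (countL-via-child P {cs} disjs P0 Ps)

  Bᵥ : Subset n
  Bᵥ = within G r ⁅ v ⁆

  mutual
    countN≤∣U∩Bᵥ∣ : ∀ {U} (T : SDT G U) → countN r v T ≤ ∣ U ∩ Bᵥ ∣
    countN≤∣U∩Bᵥ∣ {U} (node S S⊆U cs comps disj _) with lookup (ball G U S r) v in eq
    ... | false = ≤-trans (countL≤∣W∩Bᵥ∣ cs comps disj) (p⊆q⇒∣p∣≤∣q∣ (∩-monoˡ-⊆ (p∩q⊆p U (∁ S))))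
    ... | true with within-sym G r (proj₂ (x∈p∩q⁻ U _ (lookup⇒[]= v (ball G U S r) eq)))
    ...   | s , s∈S , s∈Bᵥ =
      ≤-trans (s≤s (countL≤∣W∩Bᵥ∣ cs comps disj)) (p⊂q⇒∣p∣<∣q∣ (∩-monoˡ-⊆ (p∩q⊆p U (∁ S)) , s , s∈U∩Bᵥ , s∉))
      where
      s∈U∩Bᵥ : s ∈ U ∩ Bᵥ
      s∈U∩Bᵥ = x∈p∩q⁺ (S⊆U s∈S , s∈Bᵥ)
      s∉ : s ∉ (U ∩ ∁ S) ∩ Bᵥ
      s∉ s∈ = x∈∁p⇒x∉p (proj₂ (x∈p∩q⁻ U _ (proj₁ (x∈p∩q⁻ _ _ s∈)))) s∈S

    countL≤∣W∩Bᵥ∣ : ∀ {W} cs → All (λ (c : Child G) → IsComponent G W (proj₁ c)) cs →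
                    AllPairs Disjoint cs → countL r v cs ≤ ∣ W ∩ Bᵥ ∣
    countL≤∣W∩Bᵥ∣ {W} cs comps disj = countL-via-child (_≤ ∣ W ∩ Bᵥ ∣) disj z≤n (children cs comps)
      where
      children : ∀ cs → All (λ (c : Child G) → IsComponent G W (proj₁ c)) cs →
                 All (λ (c : Child G) → v ∈ proj₁ c → countN r v (proj₂ c) ≤ ∣ W ∩ Bᵥ ∣) cs
      children [] [] = []
      children ((_ , t) ∷ cs) (comp ∷ comps) =
        (λ _ → ≤-trans (countN≤∣U∩Bᵥ∣ t) (p⊆q⇒∣p∣≤∣q∣ (∩-monoˡ-⊆ (component⊆ comp)))) ∷ children cs comps

  3^j≤∣U∣2^j : ∀ {U} (T : SDT G U) → Balanced T → ∀ j → j < countN r v T → 3 ^ j ≤ ∣ U ∣ * 2 ^ j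
  3^j≤∣U∣2^j {U} T _ zero 0<N = begin
    1              ≤⟨ ≤-trans (s≤s z≤n) (x∈p⇒∣p-x∣<∣p∣ (countN>0⇒∈ T 0<N)) ⟩
    ∣ U ∣          ≡⟨ *-identityʳ ∣ U ∣ ⟨
    ∣ U ∣ * 1      ∎
    where open ≤-Reasoning
  3^j≤∣U∣2^j {U} (node S _ cs _ disj _) bal (suc j) j<N =
    countL-via-child P disj (λ _ ()) (children cs bal) j (suc<indicator+⇒< (lookup (ball G U S r) v) j<N)
    where
    P : ℕ → Set
    P m = ∀ j → j < m → 3 ^ suc j ≤ ∣ U ∣ * 2 ^ suc j
    children : ∀ cs → BalancedL U cs → All (λ (c : Child G) → v ∈ proj₁ c → P (countN r v (proj₂ c))) cs
    children [] _ = []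
    children ((U′ , t) ∷ cs) (3∣U′∣≤2∣U∣ , bal-t , bal-cs) =
      (λ _ j j<N → 3^j≤a2^j⇒3^[1+j]≤b2^[1+j] ∣ U′ ∣ ∣ U ∣ j 3∣U′∣≤2∣U∣ (3^j≤∣U∣2^j t bal-t j j<N))
      ∷ children cs bal-cs

lemma4p9 : ∀ {n : ℕ} (G : Graph n) (T : SDT G ⊤) (r : ℕ) →
    ((Δ : ℕ) → 3 ≤ Δ → MaxDegree G Δ →
      ∀ v → countN r v T ≤ 1 + Δ * geom (Δ ∸ 1) r)
    × (3 ≤ n → Balanced T → ∀ v → LeFourLog (countN r v T) n)
lemma4p9 {n} G T r = bounded-degree , balanced
  where
  bounded-degree : (Δ : ℕ) → 3 ≤ Δ → MaxDegree G Δ → ∀ v → countN r v T ≤ 1 + Δ * geom (Δ ∸ 1) r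
  bounded-degree Δ _ (deg≤Δ , _) v = begin
    countN r v T                           ≤⟨ countN≤∣U∩Bᵥ∣ r v T ⟩
    ∣ ⊤ ∩ within G r ⁅ v ⁆ ∣               ≤⟨ ∣p∩q∣≤∣q∣ ⊤ (within G r ⁅ v ⁆) ⟩
    ∣ within G r ⁅ v ⁆ ∣                   ≤⟨ ∣within∣≤ G deg≤Δ ⁅ v ⁆ r ⟩
    ∣ ⁅ v ⁆ ∣ * (1 + Δ * geom (Δ ∸ 1) r)   ≡⟨ cong (_* _) (∣⁅x⁆∣≡1 v) ⟩
    1 * (1 + Δ * geom (Δ ∸ 1) r)           ≡⟨ *-identityˡ _ ⟩
    1 + Δ * geom (Δ ∸ 1) r                 ∎
    where open ≤-Reasoning
  balanced : 3 ≤ n → Balanced T → ∀ v → LeFourLog (countN r v T) n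
  balanced 3≤n bal v = 3^j≤n2^j⇒LeFourLog 3≤n λ j j<N →
    subst (λ m → 3 ^ j ≤ m * 2 ^ j) (∣⊤∣≡n n) (3^j≤∣U∣2^j r v T bal j j<N)
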